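{- For any $n\geq2$ and $m\geq1$, \[ \Omega_n(m)=\Omega_n(m-1)+\Omega_{n-2}(m)+\sum_{0\le j\le (n-2)/2}\Omega_{2j+1}(m-1)\,\Omega_{n-2-2j}(m) \] and \[ \Omega_n(m)=\Omega_n(m-1)+\sum_{0\le j\le (n-1)/2}\Omega_{2j}(m-1)\,\Omega_{n-1-2j}(m). \]
   Context: For $n\ge1$ and $m\ge0$, let $\Omega_n(m)$ be the number of maps $g:[n]\to\{1,\dots,m\}$ with $g(j)\le g(j+1)$ for odd $j\in[n-1]$ and $g(j)\ge g(j+1)$ for even $j\in[n-1]$ (so $\Omega_n(0)=0$); set $\Omega_0(m)=1$ for all $m\ge0$. (Equivalently $\Omega_n(m)$ is the order polynomial of a naturally labeled zig-zag poset on $n$ elements.) -}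

module Defs where

open import Data.Nat using (ℕ; zero; suc; _+_; _*_; _≤ᵇ_)
open import Data.Bool using (Bool; true; false; not; _∧_)
open import Data.List using (List; []; _∷_; map; concatMap; upTo; filterᵇ; length)
open import Data.Nat.ListAction using (sum)
open import Data.Vec using (Vec; []; _∷_)

-- All maps g : [n] → {1,…,m}, represented as vectors (g(1), …, g(n)).
maps : (n m : ℕ) → List (Vec ℕ n)
maps zero    m = [] ∷ []
maps (suc n) m = concatMap (λ a → map (a ∷_) (maps n m)) (map suc (upTo m))

-- zig b v : the zig-zag condition on consecutive entries of v, where
-- b = true means the first comparison is g(j) ≤ g(j+1) (j odd) and the
-- comparisons then alternate (even j: g(j) ≥ g(j+1)).
zig : {n : ℕ} → Bool → Vec ℕ n → Bool
zig b []           = true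
zig b (x ∷ [])     = true
zig true  (x ∷ y ∷ v) = (x ≤ᵇ y) ∧ zig false (y ∷ v)
zig false (x ∷ y ∷ v) = (y ≤ᵇ x) ∧ zig true  (y ∷ v)

-- Ω n m : number of maps g : [n] → {1..m} with g(j) ≤ g(j+1) for odd j and
-- g(j) ≥ g(j+1) for even j.  For n = 0 there is exactly one (empty) map, so Ω 0 m = 1.
Ω : ℕ → ℕ → ℕ
Ω n m = length (filterᵇ (zig true) (maps n m))

sumTo : ℕ → (ℕ → ℕ) → ℕ
sumTo k f = sum (map f (upTo (suc k)))

-- Classify the maps g : [n] → [1..m] that use the value m by the first position p with g p = m.
-- The values before p lie in [1..m−1] and the comparison into p must be an ascent, so p is even
-- (or p = 1, which forces g 2 = m as well); after p the comparison out of p is a descent, which m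
-- satisfies automatically, so the tail is counted by Ω again.  This is the first identity.
-- The complement g ↦ m+1−g turns the pattern ≤ ≥ ≤ … into its mirror ≥ ≤ ≥ …, so both patterns
-- have the same counts; the same decomposition for the mirrored pattern gives the second one.
-- The counting runs through transfer-matrix recursions indexed by the value of the previous entry.
module Submission where

open import Defs
open import Data.Nat using (ℕ; _+_; _*_; _∸_; _≤_; ⌊_/2⌋)
open import Data.Product using (_×_)
open import Relation.Binary.PropositionalEquality using (_≡_)

open import Algebra.Properties.CommutativeSemigroup as CommutativeSemigroupProperties using ()
open import Data.Bool using (Bool; true; false; not; T; _∧_)
open import Data.Bool.Properties using (T-≡)
open import Data.List using (List; []; _∷_; _++_; map; concatMap; upTo; applyUpTo; filterᵇ; length)
open import Data.List.Properties using (map-cong; map-∘; map-applyUpTo; applyUpTo-∷ʳ; filter-++; length-++)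
open import Data.Nat using (zero; suc; _<_; _≤ᵇ_; z≤n; s≤s)
open import Data.Nat.ListAction using (sum)
open import Data.Nat.ListAction.Properties using (sum-++)
open import Data.Nat.Properties
open import Data.Product using (_,_)
open import Data.Unit using (tt)
open import Data.Vec using (Vec; _∷_)
open import Function using (_∘_; Equivalence)
open import Relation.Nullary using (yes; no; T?; contradiction)
open import Relation.Binary.PropositionalEquality
  using (refl; sym; trans; cong; cong₂; subst; module ≡-Reasoning)

open ≡-Reasoning
module +-CS = CommutativeSemigroupProperties +-commutativeSemigroup
module *-CS = CommutativeSemigroupProperties *-commutativeSemigroup

⟦_⟧ : Bool → ℕ
⟦ true  ⟧ = 1
⟦ false ⟧ = 0

≤⇒≤ᵇ≡true : ∀ {m n} → m ≤ n → (m ≤ᵇ n) ≡ true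
≤⇒≤ᵇ≡true = Equivalence.to T-≡ ∘ ≤⇒≤ᵇ

>⇒≤ᵇ≡false : ∀ {m n} → n < m → (m ≤ᵇ n) ≡ false
>⇒≤ᵇ≡false {m} {n} n<m with m ≤ᵇ n in eq
... | false = refl
... | true  = contradiction (≤ᵇ⇒≤ m n (subst T (sym eq) tt)) (<⇒≱ n<m)

≤ᵇ-∸-antitone : ∀ {N} a {c} → c ≤ N → (N ∸ a ≤ᵇ N ∸ c) ≡ (c ≤ᵇ a)
≤ᵇ-∸-antitone {N} a {c} c≤N with c ≤? a
... | yes c≤a = trans (≤⇒≤ᵇ≡true (∸-monoʳ-≤ N c≤a)) (sym (≤⇒≤ᵇ≡true c≤a))
... | no  c≰a = trans (>⇒≤ᵇ≡false (∸-monoʳ-< (≰⇒> c≰a) c≤N)) (sym (>⇒≤ᵇ≡false (≰⇒> c≰a)))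

∑ : ℕ → (ℕ → ℕ) → ℕ
∑ zero    f = 0
∑ (suc M) f = ∑ M f + f (suc M)

∑-cong-range : ∀ M {f g : ℕ → ℕ} → (∀ {c} → 1 ≤ c → c ≤ M → f c ≡ g c) → ∑ M f ≡ ∑ M g
∑-cong-range zero    eq = refl
∑-cong-range (suc M) eq =
  cong₂ _+_ (∑-cong-range M (λ 1≤c c≤M → eq 1≤c (m≤n⇒m≤1+n c≤M))) (eq (s≤s z≤n) ≤-refl)

∑-cong : ∀ M {f g : ℕ → ℕ} → (∀ c → f c ≡ g c) → ∑ M f ≡ ∑ M g
∑-cong M eq = ∑-cong-range M (λ {c} _ _ → eq c)

∑-zero : ∀ M → ∑ M (λ _ → 0) ≡ 0
∑-zero zero    = refl
∑-zero (suc M) = trans (+-identityʳ _) (∑-zero M)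

∑-+ : ∀ M (f g : ℕ → ℕ) → ∑ M (λ c → f c + g c) ≡ ∑ M f + ∑ M g
∑-+ zero    f g = refl
∑-+ (suc M) f g =
  trans (cong (_+ (f (suc M) + g (suc M))) (∑-+ M f g)) (+-CS.interchange (∑ M f) (∑ M g) (f (suc M)) (g (suc M)))

∑-*ˡ : ∀ M x (f : ℕ → ℕ) → ∑ M (λ c → x * f c) ≡ x * ∑ M f
∑-*ˡ zero    x f = sym (*-zeroʳ x)
∑-*ˡ (suc M) x f = trans (cong (_+ x * f (suc M)) (∑-*ˡ M x f)) (sym (*-distribˡ-+ x (∑ M f) (f (suc M))))

∑-*ʳ : ∀ M (f : ℕ → ℕ) x → ∑ M (λ c → f c * x) ≡ ∑ M f * x
∑-*ʳ zero    f x = refl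
∑-*ʳ (suc M) f x = trans (cong (_+ f (suc M) * x) (∑-*ʳ M f x)) (sym (*-distribʳ-+ x (∑ M f) (f (suc M))))

∑-head : ∀ M (f : ℕ → ℕ) → ∑ (suc M) f ≡ f 1 + ∑ M (f ∘ suc)
∑-head zero    f = +-comm 0 (f 1)
∑-head (suc M) f = trans (cong (_+ f (suc (suc M))) (∑-head M f)) (+-assoc (f 1) (∑ M (f ∘ suc)) (f (suc (suc M))))

∑-reverse : ∀ M (f : ℕ → ℕ) → ∑ M f ≡ ∑ M (λ c → f (suc M ∸ c))
∑-reverse zero    f = refl
∑-reverse (suc M) f = begin
  ∑ M f + f (suc M)                           ≡⟨ cong (_+ f (suc M)) (∑-reverse M f) ⟩
  ∑ M (λ c → f (suc M ∸ c)) + f (suc M)       ≡⟨ +-comm _ (f (suc M)) ⟩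
  f (suc M) + ∑ M (λ c → f (suc M ∸ c))       ≡⟨ ∑-head M (λ c → f (suc (suc M) ∸ c)) ⟨
  ∑ (suc M) (λ c → f (suc (suc M) ∸ c))       ∎

sum-map-suc-upTo : ∀ M (f : ℕ → ℕ) → sum (map f (map suc (upTo M))) ≡ ∑ M f
sum-map-suc-upTo M f = begin
  sum (map f (map suc (upTo M)))  ≡⟨ cong sum (map-∘ (upTo M)) ⟨
  sum (map (f ∘ suc) (upTo M))    ≡⟨ cong sum (map-applyUpTo (λ i → i) (f ∘ suc) M) ⟩
  sum (applyUpTo (f ∘ suc) M)     ≡⟨ sum-applyUpTo M ⟩
  ∑ M f                           ∎
  where
  sum-applyUpTo : ∀ M → sum (applyUpTo (f ∘ suc) M) ≡ ∑ M f
  sum-applyUpTo zero    = refl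
  sum-applyUpTo (suc M) = begin
    sum (applyUpTo (f ∘ suc) (suc M))                         ≡⟨ cong sum (applyUpTo-∷ʳ (f ∘ suc) M) ⟨
    sum (applyUpTo (f ∘ suc) M ++ f (suc M) ∷ [])             ≡⟨ sum-++ (applyUpTo (f ∘ suc) M) _ ⟩
    sum (applyUpTo (f ∘ suc) M) + (f (suc M) + 0)             ≡⟨ cong₂ _+_ (sum-applyUpTo M) (+-identityʳ _) ⟩
    ∑ M f + f (suc M)                                         ∎

sumTo-suc : ∀ K (f : ℕ → ℕ) → sumTo (suc K) f ≡ f 0 + sumTo K (f ∘ suc)
sumTo-suc K f = cong (λ xs → f 0 + sum xs)
  (trans (map-applyUpTo suc f (suc K)) (sym (map-applyUpTo (λ i → i) (f ∘ suc) (suc K))))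

sumTo-cong : ∀ K {f g : ℕ → ℕ} → (∀ j → f j ≡ g j) → sumTo K f ≡ sumTo K g
sumTo-cong K eq = cong sum (map-cong eq (upTo (suc K)))

conv : (ℕ → ℕ) → (ℕ → ℕ) → ℕ → ℕ
conv x y zero    = 0
conv x y (suc n) = x 0 * y n + conv (x ∘ suc) y n

conv-cong : ∀ n {x x′ : ℕ → ℕ} y → (∀ i → x i ≡ x′ i) → conv x y n ≡ conv x′ y n
conv-cong zero    y eq = refl
conv-cong (suc n) y eq = cong₂ _+_ (cong (_* y n) (eq 0)) (conv-cong n y (eq ∘ suc))

conv-*ˡ : ∀ n w (x y : ℕ → ℕ) → w * conv x y n ≡ conv (λ i → w * x i) y n
conv-*ˡ zero    w x y = *-zeroʳ w
conv-*ˡ (suc n) w x y = begin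
  w * (x 0 * y n + conv (x ∘ suc) y n)        ≡⟨ *-distribˡ-+ w (x 0 * y n) _ ⟩
  w * (x 0 * y n) + w * conv (x ∘ suc) y n    ≡⟨ cong₂ _+_ (sym (*-assoc w (x 0) (y n))) (conv-*ˡ n w (x ∘ suc) y) ⟩
  w * x 0 * y n + conv (λ i → w * x (suc i)) y n ∎

∑-conv : ∀ M n (x : ℕ → ℕ → ℕ) y → ∑ M (λ c → conv (x c) y n) ≡ conv (λ i → ∑ M (λ c → x c i)) y n
∑-conv M zero    x y = ∑-zero M
∑-conv M (suc n) x y = begin
  ∑ M (λ c → x c 0 * y n + conv (x c ∘ suc) y n)
    ≡⟨ ∑-+ M (λ c → x c 0 * y n) (λ c → conv (x c ∘ suc) y n) ⟩
  ∑ M (λ c → x c 0 * y n) + ∑ M (λ c → conv (x c ∘ suc) y n)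
    ≡⟨ cong₂ _+_ (∑-*ʳ M (λ c → x c 0) (y n)) (∑-conv M n (λ c → x c ∘ suc) y) ⟩
  ∑ M (λ c → x c 0) * y n + conv (λ i → ∑ M (λ c → x c (suc i))) y n ∎

alternate : ℕ → Bool → Bool
alternate zero    b = b
alternate (suc i) b = alternate i (not b)

conv-even-terms : ∀ n (x y : ℕ → ℕ) →
  conv (λ i → ⟦ alternate i true ⟧ * x i) y (suc n) ≡ sumTo ⌊ n /2⌋ (λ j → x (2 * j) * y (n ∸ 2 * j))
conv-even-terms zero          x y = cong (λ t → t * y 0 + 0) (*-identityˡ (x 0))
conv-even-terms (suc zero)    x y = cong (λ t → t * y 1 + 0) (*-identityˡ (x 0))
conv-even-terms (suc (suc n)) x y = begin
  1 * x 0 * y (2 + n) + conv (λ i → ⟦ alternate i true ⟧ * x (2 + i)) y (suc n)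
    ≡⟨ cong₂ _+_ (cong (_* y (2 + n)) (*-identityˡ (x 0))) (conv-even-terms n (x ∘ suc ∘ suc) y) ⟩
  x 0 * y (2 + n) + sumTo ⌊ n /2⌋ (λ j → x (2 + 2 * j) * y (n ∸ 2 * j))
    ≡⟨ cong (x 0 * y (2 + n) +_) (sumTo-cong ⌊ n /2⌋ (λ j →
         cong (λ t → x t * y (2 + n ∸ t)) (sym (*-suc 2 j)))) ⟩
  x 0 * y (2 + n) + sumTo ⌊ n /2⌋ (λ j → x (2 * suc j) * y (2 + n ∸ 2 * suc j))
    ≡⟨ sumTo-suc ⌊ n /2⌋ (λ j → x (2 * j) * y (2 + n ∸ 2 * j)) ⟨
  sumTo ⌊ 2 + n /2⌋ (λ j → x (2 * j) * y (2 + n ∸ 2 * j)) ∎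

module _ {A : Set} where

  length-filterᵇ-++ : (p : A → Bool) (xs ys : List A) →
    length (filterᵇ p (xs ++ ys)) ≡ length (filterᵇ p xs) + length (filterᵇ p ys)
  length-filterᵇ-++ p xs ys = trans (cong length (filter-++ (T? ∘ p) xs ys)) (length-++ (filterᵇ p xs))

  length-filterᵇ-∧ : (b : Bool) (p : A → Bool) (xs : List A) →
    length (filterᵇ (λ x → b ∧ p x) xs) ≡ ⟦ b ⟧ * length (filterᵇ p xs)
  length-filterᵇ-∧ true  p xs       = sym (*-identityˡ _)
  length-filterᵇ-∧ false p []       = refl
  length-filterᵇ-∧ false p (x ∷ xs) = length-filterᵇ-∧ false p xs

module _ {A B : Set} where

  length-filterᵇ-map : (p : B → Bool) (f : A → B) (xs : List A) →
    length (filterᵇ p (map f xs)) ≡ length (filterᵇ (p ∘ f) xs)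
  length-filterᵇ-map p f []       = refl
  length-filterᵇ-map p f (x ∷ xs) with p (f x)
  ... | true  = cong suc (length-filterᵇ-map p f xs)
  ... | false = length-filterᵇ-map p f xs

  length-filterᵇ-concatMap : (p : B → Bool) (f : A → List B) (xs : List A) →
    length (filterᵇ p (concatMap f xs)) ≡ sum (map (λ x → length (filterᵇ p (f x))) xs)
  length-filterᵇ-concatMap p f []       = refl
  length-filterᵇ-concatMap p f (x ∷ xs) = trans (length-filterᵇ-++ p (f x) (concatMap f xs))
    (cong (length (filterᵇ p (f x)) +_) (length-filterᵇ-concatMap p f xs))

length-filterᵇ-maps-suc : ∀ n M (p : Vec ℕ (suc n) → Bool) →
  length (filterᵇ p (maps (suc n) M)) ≡ ∑ M (λ c → length (filterᵇ (p ∘ (c ∷_)) (maps n M)))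
length-filterᵇ-maps-suc n M p = begin
  length (filterᵇ p (maps (suc n) M))
    ≡⟨ length-filterᵇ-concatMap p (λ c → map (c ∷_) (maps n M)) (map suc (upTo M)) ⟩
  sum (map (λ c → length (filterᵇ p (map (c ∷_) (maps n M)))) (map suc (upTo M)))
    ≡⟨ cong sum (map-cong (λ c → length-filterᵇ-map p (c ∷_) (maps n M)) (map suc (upTo M))) ⟩
  sum (map (λ c → length (filterᵇ (p ∘ (c ∷_)) (maps n M))) (map suc (upTo M)))
    ≡⟨ sum-map-suc-upTo M _ ⟩
  ∑ M (λ c → length (filterᵇ (p ∘ (c ∷_)) (maps n M))) ∎

Ωᵇ : Bool → ℕ → ℕ → ℕ
Ωᵇ b n M = length (filterᵇ (zig b) (maps n M))

zigStep : Bool → ℕ → ℕ → Bool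
zigStep true  a c = a ≤ᵇ c
zigStep false a c = c ≤ᵇ a

extensions : Bool → ℕ → ℕ → ℕ → ℕ
extensions b zero    M a = 1
extensions b (suc n) M a = ∑ M (λ c → ⟦ zigStep b a c ⟧ * extensions (not b) n M c)

length-filterᵇ-zig-∷ : ∀ b n M a →
  length (filterᵇ (λ v → zig b (a ∷ v)) (maps n M)) ≡ extensions b n M a
length-filterᵇ-zig-∷ b     zero    M a = refl
length-filterᵇ-zig-∷ true  (suc n) M a = trans (length-filterᵇ-maps-suc n M _) (∑-cong M λ c →
  trans (length-filterᵇ-∧ (a ≤ᵇ c) _ (maps n M)) (cong (⟦ a ≤ᵇ c ⟧ *_) (length-filterᵇ-zig-∷ false n M c)))
length-filterᵇ-zig-∷ false (suc n) M a = trans (length-filterᵇ-maps-suc n M _) (∑-cong M λ c →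
  trans (length-filterᵇ-∧ (c ≤ᵇ a) _ (maps n M)) (cong (⟦ c ≤ᵇ a ⟧ *_) (length-filterᵇ-zig-∷ true n M c)))

Ωᵇ-suc : ∀ b n M → Ωᵇ b (suc n) M ≡ ∑ M (extensions b n M)
Ωᵇ-suc b n M = trans (length-filterᵇ-maps-suc n M (zig b)) (∑-cong M (length-filterᵇ-zig-∷ b n M))

extensions-complement : ∀ n M a → extensions false n M a ≡ extensions true n M (suc M ∸ a)
extensions-complement zero    M a = refl
extensions-complement (suc n) M a = begin
  ∑ M (λ c → ⟦ c ≤ᵇ a ⟧ * extensions true n M c)
    ≡⟨ ∑-cong-range M (λ {c} _ c≤M → cong₂ _*_
         (cong ⟦_⟧ (sym (≤ᵇ-∸-antitone a (m≤n⇒m≤1+n c≤M))))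
         (trans (cong (extensions true n M) (sym (m∸[m∸n]≡n (m≤n⇒m≤1+n c≤M))))
                (sym (extensions-complement n M (suc M ∸ c))))) ⟩
  ∑ M (λ c → ⟦ suc M ∸ a ≤ᵇ suc M ∸ c ⟧ * extensions false n M (suc M ∸ c))
    ≡⟨ ∑-reverse M (λ c → ⟦ suc M ∸ a ≤ᵇ c ⟧ * extensions false n M c) ⟨
  ∑ M (λ c → ⟦ suc M ∸ a ≤ᵇ c ⟧ * extensions false n M c) ∎

Ωᵇ-complement : ∀ n M → Ωᵇ false n M ≡ Ω n M
Ωᵇ-complement zero    M = refl
Ωᵇ-complement (suc n) M = begin
  Ωᵇ false (suc n) M                          ≡⟨ Ωᵇ-suc false n M ⟩
  ∑ M (extensions false n M)                  ≡⟨ ∑-cong M (extensions-complement n M) ⟩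
  ∑ M (λ c → extensions true n M (suc M ∸ c)) ≡⟨ ∑-reverse M (extensions true n M) ⟨
  ∑ M (extensions true n M)                   ≡⟨ Ωᵇ-suc true n M ⟨
  Ω (suc n) M                                 ∎

extensions-false-top : ∀ n M → extensions false n M M ≡ Ω n M
extensions-false-top zero    M = refl
extensions-false-top (suc n) M = begin
  ∑ M (λ c → ⟦ c ≤ᵇ M ⟧ * extensions true n M c)
    ≡⟨ ∑-cong-range M (λ {c} _ c≤M → trans (cong (λ t → ⟦ t ⟧ * extensions true n M c) (≤⇒≤ᵇ≡true c≤M))
                                           (*-identityˡ _)) ⟩
  ∑ M (extensions true n M) ≡⟨ Ωᵇ-suc true n M ⟨
  Ω (suc n) M               ∎

extensions-true-top : ∀ n k → extensions true (suc n) (suc k) (suc k) ≡ Ω n (suc k)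
extensions-true-top n k = begin
  ∑ k (λ c → ⟦ suc k ≤ᵇ c ⟧ * e c) + ⟦ suc k ≤ᵇ suc k ⟧ * e (suc k)
    ≡⟨ cong₂ _+_ (∑-cong-range k (λ {c} _ c≤k → cong (λ t → ⟦ t ⟧ * e c) (>⇒≤ᵇ≡false (s≤s c≤k))))
                 (cong (λ t → ⟦ t ⟧ * e (suc k)) (≤⇒≤ᵇ≡true (≤-refl {suc k}))) ⟩
  ∑ k (λ c → 0 * e c) + 1 * e (suc k) ≡⟨ cong₂ _+_ (∑-*ˡ k 0 e) (*-identityˡ _) ⟩
  e (suc k)                           ≡⟨ extensions-false-top n (suc k) ⟩
  Ω n (suc k)                         ∎
  where
  e : ℕ → ℕ
  e = extensions false n (suc k)

extensions-step-to-top : ∀ b n {a k} → a ≤ k →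
  ⟦ zigStep b a (suc k) ⟧ * extensions (not b) n (suc k) (suc k) ≡ ⟦ b ⟧ * Ω n (suc k)
extensions-step-to-top true  n {k = k} a≤k =
  cong₂ _*_ (cong ⟦_⟧ (≤⇒≤ᵇ≡true (m≤n⇒m≤1+n a≤k))) (extensions-false-top n (suc k))
extensions-step-to-top false n {k = k} a≤k =
  cong (λ t → ⟦ t ⟧ * extensions true n (suc k) (suc k)) (>⇒≤ᵇ≡false (s≤s a≤k))

module _ (k : ℕ) where

  -- Split off the first step up to k+1: the prefix of length i before it stays in [1..k] and
  -- must end in an ascent, and after it comes a descent, which k+1 always admits.
  extensions-split-top : ∀ b n a → a ≤ k →
    extensions b n (suc k) a ≡ extensions b n k a
      + conv (λ i → ⟦ alternate i b ⟧ * extensions b i k a) (λ i → Ω i (suc k)) n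
  extensions-split-top b zero    a a≤k = refl
  extensions-split-top b (suc n) a a≤k = begin
    ∑ k (λ c → ⟦ zigStep b a c ⟧ * extensions (not b) n (suc k) c) + ⟦ zigStep b a (suc k) ⟧ * e (suc k) (suc k)
      ≡⟨ cong₂ _+_ below-top (extensions-step-to-top b n a≤k) ⟩
    extensions b (suc n) k a + conv (x ∘ suc) ω n + ⟦ b ⟧ * ω n
      ≡⟨ +-CS.xy∙z≈x∙zy (extensions b (suc n) k a) _ _ ⟩
    extensions b (suc n) k a + (⟦ b ⟧ * ω n + conv (x ∘ suc) ω n)
      ≡⟨ cong (λ t → extensions b (suc n) k a + (t * ω n + conv (x ∘ suc) ω n)) (*-identityʳ ⟦ b ⟧) ⟨
    extensions b (suc n) k a + conv x ω (suc n) ∎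
    where
    ω : ℕ → ℕ
    ω i = Ω i (suc k)
    e : ℕ → ℕ → ℕ
    e = extensions (not b) n
    x : ℕ → ℕ
    x i = ⟦ alternate i b ⟧ * extensions b i k a
    s : ℕ → ℕ
    s c = ⟦ zigStep b a c ⟧

    below-top : ∑ k (λ c → s c * e (suc k) c) ≡ extensions b (suc n) k a + conv (x ∘ suc) ω n
    below-top = begin
      ∑ k (λ c → s c * e (suc k) c)
        ≡⟨ ∑-cong-range k (λ {c} _ c≤k → cong (s c *_) (extensions-split-top (not b) n c c≤k)) ⟩
      ∑ k (λ c → s c * (e k c + conv (y c) ω n))
        ≡⟨ ∑-cong k (λ c → *-distribˡ-+ (s c) (e k c) _) ⟩
      ∑ k (λ c → s c * e k c + s c * conv (y c) ω n)
        ≡⟨ ∑-+ k (λ c → s c * e k c) _ ⟩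
      extensions b (suc n) k a + ∑ k (λ c → s c * conv (y c) ω n)
        ≡⟨ cong (extensions b (suc n) k a +_) (trans (∑-cong k (λ c → conv-*ˡ n (s c) (y c) ω))
                                                   (∑-conv k n (λ c i → s c * y c i) ω)) ⟩
      extensions b (suc n) k a + conv (λ i → ∑ k (λ c → s c * y c i)) ω n
        ≡⟨ cong (extensions b (suc n) k a +_) (conv-cong n ω (λ i →
             trans (∑-cong k (λ c → *-CS.x∙yz≈y∙xz (s c) ⟦ alternate i (not b) ⟧ (extensions (not b) i k c))) (∑-*ˡ k ⟦ alternate i (not b) ⟧ _))) ⟩
      extensions b (suc n) k a + conv (x ∘ suc) ω n ∎
      where
      y : ℕ → ℕ → ℕ
      y c i = ⟦ alternate i (not b) ⟧ * extensions (not b) i k c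

  Ωᵇ-split-top : ∀ b n →
    Ωᵇ b (suc n) (suc k) ≡ Ωᵇ b (suc n) k
      + conv (λ i → ⟦ alternate i b ⟧ * Ωᵇ b (suc i) k) (λ i → Ω i (suc k)) n
      + extensions b n (suc k) (suc k)
  Ωᵇ-split-top b n = begin
    Ωᵇ b (suc n) (suc k)
      ≡⟨ Ωᵇ-suc b n (suc k) ⟩
    ∑ k (extensions b n (suc k)) + extensions b n (suc k) (suc k)
      ≡⟨ cong (_+ extensions b n (suc k) (suc k)) below-top ⟩
    Ωᵇ b (suc n) k + conv (λ i → ⟦ alternate i b ⟧ * Ωᵇ b (suc i) k) ω n + extensions b n (suc k) (suc k) ∎
    where
    ω : ℕ → ℕ
    ω i = Ω i (suc k)
    x : ℕ → ℕ → ℕ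
    x c i = ⟦ alternate i b ⟧ * extensions b i k c

    below-top : ∑ k (extensions b n (suc k)) ≡ Ωᵇ b (suc n) k + conv (λ i → ⟦ alternate i b ⟧ * Ωᵇ b (suc i) k) ω n
    below-top = begin
      ∑ k (extensions b n (suc k))
        ≡⟨ ∑-cong-range k (λ {c} _ c≤k → extensions-split-top b n c c≤k) ⟩
      ∑ k (λ c → extensions b n k c + conv (x c) ω n)
        ≡⟨ ∑-+ k (extensions b n k) (λ c → conv (x c) ω n) ⟩
      ∑ k (extensions b n k) + ∑ k (λ c → conv (x c) ω n)
        ≡⟨ cong₂ _+_ (sym (Ωᵇ-suc b n k)) (∑-conv k n x ω) ⟩
      Ωᵇ b (suc n) k + conv (λ i → ∑ k (λ c → x c i)) ω n
        ≡⟨ cong (Ωᵇ b (suc n) k +_) (conv-cong n ω (λ i →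
             trans (∑-*ˡ k ⟦ alternate i b ⟧ (extensions b i k)) (cong (⟦ alternate i b ⟧ *_) (sym (Ωᵇ-suc b i k))))) ⟩
      Ωᵇ b (suc n) k + conv (λ i → ⟦ alternate i b ⟧ * Ωᵇ b (suc i) k) ω n ∎

  Ω-recurrence₁ : ∀ n → Ω (2 + n) (suc k) ≡ Ω (2 + n) k + Ω n (suc k)
    + sumTo ⌊ n /2⌋ (λ j → Ω (2 * j + 1) k * Ω (n ∸ 2 * j) (suc k))
  Ω-recurrence₁ n = begin
    Ω (2 + n) (suc k)
      ≡⟨ Ωᵇ-split-top true (suc n) ⟩
    Ω (2 + n) k + conv (λ i → ⟦ alternate i true ⟧ * Ω (suc i) k) ω (suc n) + extensions true (suc n) (suc k) (suc k)
      ≡⟨ cong₂ _+_ (cong (Ω (2 + n) k +_) (conv-even-terms n (λ i → Ω (suc i) k) ω)) (extensions-true-top n k) ⟩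
    Ω (2 + n) k + sumTo ⌊ n /2⌋ (λ j → Ω (suc (2 * j)) k * ω (n ∸ 2 * j)) + ω n
      ≡⟨ +-CS.xy∙z≈xz∙y (Ω (2 + n) k) _ (ω n) ⟩
    Ω (2 + n) k + ω n + sumTo ⌊ n /2⌋ (λ j → Ω (suc (2 * j)) k * ω (n ∸ 2 * j))
      ≡⟨ cong (Ω (2 + n) k + ω n +_) (sumTo-cong ⌊ n /2⌋ (λ j →
           cong (λ t → Ω t k * ω (n ∸ 2 * j)) (+-comm 1 (2 * j)))) ⟩
    Ω (2 + n) k + ω n + sumTo ⌊ n /2⌋ (λ j → Ω (2 * j + 1) k * ω (n ∸ 2 * j)) ∎
    where
    ω : ℕ → ℕ
    ω i = Ω i (suc k)

  Ω-recurrence₂ : ∀ n → Ω (suc n) (suc k) ≡ Ω (suc n) k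
    + sumTo ⌊ n /2⌋ (λ j → Ω (2 * j) k * Ω (n ∸ 2 * j) (suc k))
  Ω-recurrence₂ n = begin
    Ω (suc n) (suc k)
      ≡⟨ Ωᵇ-complement (suc n) (suc k) ⟨
    Ωᵇ false (suc n) (suc k)
      ≡⟨ Ωᵇ-split-top false n ⟩
    Ωᵇ false (suc n) k + conv (x ∘ suc) ω n + extensions false n (suc k) (suc k)
      ≡⟨ cong₂ _+_ (cong (_+ conv (x ∘ suc) ω n) (Ωᵇ-complement (suc n) k)) (extensions-false-top n (suc k)) ⟩
    Ω (suc n) k + conv (x ∘ suc) ω n + ω n
      ≡⟨ +-CS.xy∙z≈x∙zy (Ω (suc n) k) (conv (x ∘ suc) ω n) (ω n) ⟩
    Ω (suc n) k + (ω n + conv (x ∘ suc) ω n)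
      ≡⟨ cong (λ t → Ω (suc n) k + (t + conv (x ∘ suc) ω n)) (*-identityˡ (ω n)) ⟨
    Ω (suc n) k + conv x ω (suc n)
      ≡⟨ cong (Ω (suc n) k +_) (conv-even-terms n (λ i → Ωᵇ false i k) ω) ⟩
    Ω (suc n) k + sumTo ⌊ n /2⌋ (λ j → Ωᵇ false (2 * j) k * ω (n ∸ 2 * j))
      ≡⟨ cong (Ω (suc n) k +_) (sumTo-cong ⌊ n /2⌋ (λ j →
           cong (_* ω (n ∸ 2 * j)) (Ωᵇ-complement (2 * j) k))) ⟩
    Ω (suc n) k + sumTo ⌊ n /2⌋ (λ j → Ω (2 * j) k * ω (n ∸ 2 * j)) ∎
    where
    ω : ℕ → ℕ
    ω i = Ω i (suc k)
    x : ℕ → ℕ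
    x i = ⟦ alternate i true ⟧ * Ωᵇ false i k

proposition3p17 : (n m : ℕ) → 2 ≤ n → 1 ≤ m →
    (Ω n m ≡ Ω n (m ∸ 1) + Ω (n ∸ 2) m
        + sumTo ⌊ n ∸ 2 /2⌋ (λ j → Ω (2 * j + 1) (m ∸ 1) * Ω (n ∸ 2 ∸ 2 * j) m))
    × (Ω n m ≡ Ω n (m ∸ 1)
        + sumTo ⌊ n ∸ 1 /2⌋ (λ j → Ω (2 * j) (m ∸ 1) * Ω (n ∸ 1 ∸ 2 * j) m))
proposition3p17 (suc (suc n)) (suc k) (s≤s (s≤s z≤n)) (s≤s z≤n) = Ω-recurrence₁ k n , Ω-recurrence₂ k (suc n)
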